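{- Let $(s_k)_{k\ge1}$ be any sequence of positive integers. Then there exists a function $f^{(s_k)}:\mathbb{N}\to\mathbb{N}$ such that for every $i\ge1$, every word $w\in\mathcal{L}^{(s_k)}$ of length at least $f^{(s_k)}(i)$ contains $\alpha^{(s_k)}_i$ as a factor.
   Context: For a binary word $\gamma=\gamma_1\cdots\gamma_n$, its complement is $\overline{\gamma}=(1-\gamma_1)\cdots(1-\gamma_n)$. A factor of a word $w$ is a contiguous subword, i.e. $u$ is a factor of $w$ if $w=w_1uw_2$ for possibly empty words $w_1,w_2$. Given a sequence $(s_k)_{k\ge1}$ of positive integers, define binary words $\alpha^{(s_k)}_1=01$ and, for $i\ge1$, $\alpha^{(s_k)}_{i+1}=(\alpha^{(s_k)}_i)^{s_i}(\overline{\alpha}^{(s_k)}_i)^{s_i}$ (concatenation of $s_i$ copies of $\alpha^{(s_k)}_i$ followed by $s_i$ copies of its complement). Let $\mathcal{L}^{(s_k)}$ be the set of all words (including the empty word) that are factors of $\alpha^{(s_k)}_i$ for some $i\ge1$. -}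

module Defs where

open import Data.Bool using (Bool; true; false; not)
open import Data.List using (List; []; _∷_; _++_; map; concat; replicate)
open import Data.Nat using (ℕ; zero; suc; _∸_; _≤_)
open import Data.Product using (∃₂; _×_; _,_)
open import Relation.Binary.PropositionalEquality using (_≡_)

-- Binary words: false = 0, true = 1.
Word : Set
Word = List Bool

complement : Word → Word
complement = map not

pow : Word → ℕ → Word
pow u n = concat (replicate n u)

Factor : Word → Word → Set
Factor u w = ∃₂ λ w₁ w₂ → w ≡ w₁ ++ u ++ w₂

-- αFrom s n = α^{(s_k)}_{n+1}   (0-based internal indexing)
αFrom : (ℕ → ℕ) → ℕ → Word
αFrom s zero    = false ∷ true ∷ []
αFrom s (suc n) = pow (αFrom s n) (s (suc n)) ++ pow (complement (αFrom s n)) (s (suc n))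

-- α s i = α^{(s_k)}_i for i ≥ 1 (the sequence s is indexed from 1; s 0 is unused)
α : (ℕ → ℕ) → ℕ → Word
α s i = αFrom s (i ∸ 1)

InL : (ℕ → ℕ) → Word → Set
InL s w = ∃₂ λ i (_ : 1 ≤ i) → Factor w (α s i)

{-# OPTIONS --safe #-}
-- For n ≥ i + 1, α_n is a concatenation of blocks, each equal to α_{i+1} or its
-- complement.  Every word of L^{(s_k)} is a factor of such an α_n, and a factor
-- of length at least 2|α_{i+1}| of a concatenation of blocks of length |α_{i+1}|
-- contains a whole block.  Since s_i ≥ 1, both α_{i+1} and its complement contain
-- α_i, so f(i) = 2|α_{i+1}| works.
module Submission where

open import Defs
open import Data.Bool using (Bool; true; false; not)
open import Data.Bool.Properties using (not-involutive)
open import Data.List using (List; []; _∷_; _++_; length)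
open import Data.List.Properties
  using (length-++; length-map; map-++; ++-assoc; ++-identityʳ; ++-conicalˡ; ++-conicalʳ; ∷-injective)
open import Data.Nat using (ℕ; zero; suc; _+_; _≤_; _<_; z≤n; s≤s)
open import Data.Nat.Properties
  using (≤-trans; ≤-reflexive; ≤-total; m≤m+n; m≤n+m; +-comm; +-cancelˡ-≤; +-monoˡ-≤)
open import Data.Product using (Σ; ∃; ∃₂; _,_; _×_)
open import Data.Sum using (inj₁; inj₂)
open import Relation.Binary.PropositionalEquality

++-prefix : ∀ {A : Set} (a b c d : List A) → a ++ b ≡ c ++ d → length a ≤ length c →
  ∃ λ m → c ≡ a ++ m × b ≡ m ++ d
++-prefix []      b c       d eq _ = c , refl , eq
++-prefix (x ∷ a) b []      d eq ()
++-prefix (x ∷ a) b (y ∷ c) d eq (s≤s a≤c) with ∷-injective eq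
... | refl , eq′ with ++-prefix a b c d eq′ a≤c
...   | m , refl , b≡ = m , refl , b≡

length-suffix : ∀ {A : Set} {u : List A} (v r : List A) → u ≡ v ++ r → length r ≤ length u
length-suffix v r refl = ≤-trans (m≤n+m (length r) (length v)) (≤-reflexive (sym (length-++ v)))

complement-involutive : ∀ u → complement (complement u) ≡ u
complement-involutive []      = refl
complement-involutive (x ∷ u) = cong₂ _∷_ (not-involutive x) (complement-involutive u)

complement-pow : ∀ u k → complement (pow u k) ≡ pow (complement u) k
complement-pow u zero    = refl
complement-pow u (suc k) = trans (map-++ not u (pow u k)) (cong (complement u ++_) (complement-pow u k))

complement-swap : ∀ u k → complement (pow u k ++ pow (complement u) k) ≡ pow (complement u) k ++ pow u k
complement-swap u k = begin
  complement (pow u k ++ pow (complement u) k)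
    ≡⟨ map-++ not (pow u k) _ ⟩
  complement (pow u k) ++ complement (pow (complement u) k)
    ≡⟨ cong₂ _++_ (complement-pow u k) (complement-pow (complement u) k) ⟩
  pow (complement u) k ++ pow (complement (complement u)) k
    ≡⟨ cong (λ v → pow (complement u) k ++ pow v k) (complement-involutive u) ⟩
  pow (complement u) k ++ pow u k ∎
  where open ≡-Reasoning

Factor-refl : ∀ u → Factor u u
Factor-refl u = [] , [] , sym (++-identityʳ u)

Factor-++ˡ : ∀ {u v} w → Factor u v → Factor u (v ++ w)
Factor-++ˡ {u} w (a , b , refl) = a , b ++ w , trans (++-assoc a (u ++ b) w) (cong (a ++_) (++-assoc u b w))

Factor-++ʳ : ∀ {u v} w → Factor u v → Factor u (w ++ v)
Factor-++ʳ w (a , b , refl) = w ++ a , b , sym (++-assoc w a _)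

Factor-trans : ∀ {u v w} → Factor u v → Factor v w → Factor u w
Factor-trans u⊑v (c , d , refl) = Factor-++ʳ c (Factor-++ˡ d u⊑v)

Factor-pow : ∀ u k → Factor u (pow u (suc k))
Factor-pow u k = Factor-++ˡ (pow u k) (Factor-refl u)

block : Bool → Word → Word
block true  b = b
block false b = complement b

length-block : ∀ t b → length (block t b) ≡ length b
length-block true  b = refl
length-block false b = length-map not b

complement-block : ∀ t b → complement (block t b) ≡ block (not t) b
complement-block true  b = refl
complement-block false b = complement-involutive b

data Tiled (b : Word) : Word → Set where
  []  : Tiled b []
  _∷_ : ∀ t {x} → Tiled b x → Tiled b (block t b ++ x)

Tiled-++ : ∀ {b x y} → Tiled b x → Tiled b y → Tiled b (x ++ y)
Tiled-++          []             ty = ty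
Tiled-++ {b} {y = y} (_∷_ t {x} tx) ty =
  subst (Tiled b) (sym (++-assoc (block t b) x y)) (t ∷ Tiled-++ tx ty)

Tiled-complement : ∀ {b x} → Tiled b x → Tiled b (complement x)
Tiled-complement          []             = []
Tiled-complement {b} (_∷_ t {x} tx) =
  subst (Tiled b) (sym (trans (map-++ not (block t b) x) (cong (_++ complement x) (complement-block t b))))
    (not t ∷ Tiled-complement tx)

Tiled-pow : ∀ {b x} k → Tiled b x → Tiled b (pow x k)
Tiled-pow zero    tx = []
Tiled-pow (suc k) tx = Tiled-++ tx (Tiled-pow k tx)

Tiled-suffix : ∀ {b x} → Tiled b x → ∀ u y → x ≡ u ++ y →
  ∃₂ λ p z → y ≡ p ++ z × length p ≤ length b × Tiled b z
Tiled-suffix [] u y eq = [] , [] , ++-conicalʳ u y (sym eq) , z≤n , []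
Tiled-suffix {b} (_∷_ t {x} tx) u y eq with ≤-total (length u) (length (block t b))
... | inj₁ u≤block with ++-prefix u y (block t b) x (sym eq) u≤block
...   | m , block≡ , y≡ = m , x , y≡ , ≤-trans (length-suffix u m block≡) (≤-reflexive (length-block t b)) , tx
Tiled-suffix {b} (_∷_ t {x} tx) u y eq | inj₂ block≤u with ++-prefix (block t b) x u y eq block≤u
...   | m , _ , x≡ = Tiled-suffix tx m y x≡

Tiled-block-prefix : ∀ {b z} → Tiled b z → ∀ u v → z ≡ u ++ v → length b ≤ length u →
  ∃₂ λ t r → u ≡ block t b ++ r
Tiled-block-prefix {[]}    []  u v eq _ = true , u , refl
Tiled-block-prefix {_ ∷ _} []  u v eq b≤u with ++-conicalˡ u v (sym eq)
Tiled-block-prefix {_ ∷ _} [] .[] v eq () | refl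
Tiled-block-prefix {b} (_∷_ t {z} tz) u v eq b≤u
  with ++-prefix (block t b) z u v eq (≤-trans (≤-reflexive (length-block t b)) b≤u)
... | r , u≡ , _ = t , r , u≡

Tiled-Factor-block : ∀ {b x w} → Tiled b x → Factor w x → length b + length b ≤ length w →
  ∃ λ t → Factor (block t b) w
Tiled-Factor-block {b} {w = w} tx (u , v , x≡) 2b≤w
  with Tiled-suffix tx u (w ++ v) x≡
... | p , z , wv≡ , p≤b , tz
  with ++-prefix p z w v (sym wv≡) (≤-trans p≤b (≤-trans (m≤m+n (length b) (length b)) 2b≤w))
... | w′ , w≡ , z≡
  with Tiled-block-prefix tz w′ v z≡ b≤w′
  where
  -- |p| + |w′| = |w| ≥ 2|b| and |p| ≤ |b|
  b≤w′ : length b ≤ length w′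
  b≤w′ = +-cancelˡ-≤ (length b) (length b) (length w′)
    (≤-trans 2b≤w (≤-trans (≤-reflexive (trans (cong length w≡) (length-++ p)))
                           (+-monoˡ-≤ (length w′) p≤b)))
... | t , r , w′≡ = t , p , r , trans w≡ (cong (p ++_) w′≡)

αFrom-tiled : ∀ s d k → Tiled (αFrom s k) (αFrom s (d + k))
αFrom-tiled s zero    k = subst (Tiled (αFrom s k)) (++-identityʳ _) (true ∷ [])
αFrom-tiled s (suc d) k =
  Tiled-++ (Tiled-pow (s (suc (d + k))) (αFrom-tiled s d k))
           (Tiled-pow (s (suc (d + k))) (Tiled-complement (αFrom-tiled s d k)))

module _ (s : ℕ → ℕ) (pos : ∀ k → 1 ≤ k → 0 < s k) where

  Factor-αFrom-block : ∀ n t → Factor (αFrom s n) (block t (αFrom s (suc n)))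
  Factor-αFrom-block n t with s (suc n) | pos (suc n) (s≤s z≤n)
  Factor-αFrom-block n true  | suc k | _ = Factor-++ˡ _ (Factor-pow (αFrom s n) k)
  Factor-αFrom-block n false | suc k | _ =
    subst (Factor (αFrom s n)) (sym (complement-swap (αFrom s n) (suc k)))
      (Factor-++ʳ (pow (complement (αFrom s n)) (suc k)) (Factor-pow (αFrom s n) k))

  Factor-αFrom : ∀ m d → Factor (αFrom s m) (αFrom s (d + m))
  Factor-αFrom m zero    = Factor-refl (αFrom s m)
  Factor-αFrom m (suc d) = Factor-trans (Factor-αFrom m d) (Factor-αFrom-block (d + m) true)

proposition2p2 : (s : ℕ → ℕ) → (∀ k → 1 ≤ k → 0 < s k) →
    Σ (ℕ → ℕ) λ f → ∀ i → 1 ≤ i → ∀ w → InL s w → f i ≤ length w → Factor (α s i) w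
proposition2p2 s pos = f , contains-α
  where
  f : ℕ → ℕ
  f i = length (αFrom s i) + length (αFrom s i)

  contains-α : ∀ i → 1 ≤ i → ∀ w → InL s w → f i ≤ length w → Factor (α s i) w
  contains-α (suc n) _ w (suc j , _ , w⊑αⱼ) long
    with Tiled-Factor-block (αFrom-tiled s j (suc n)) (Factor-trans w⊑αⱼ αⱼ⊑αₙ) long
    where
    αⱼ⊑αₙ : Factor (αFrom s j) (αFrom s (j + suc n))
    αⱼ⊑αₙ = subst (λ N → Factor (αFrom s j) (αFrom s N)) (+-comm (suc n) j) (Factor-αFrom s pos j (suc n))
  ... | t , block⊑w = Factor-trans (Factor-αFrom-block s pos n t) block⊑w
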